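{- Let $k,\ell$ be integers with $k\ge\ell\ge5$. Then $s_Z(L_k+L_\ell)\equiv1\pmod 2$ if and only if $k=\ell+2$.
   Context: Fibonacci numbers: $F_0=0$, $F_1=1$, $F_{n+2}=F_{n+1}+F_n$. Lucas numbers: $L_0=2$, $L_1=1$, $L_{j+2}=L_{j+1}+L_j$. Every integer $n\ge 0$ has a unique Zeckendorf representation $n=\sum_{i\ge0}\varepsilon_i(n)F_{i+2}$ with $\varepsilon_i(n)\in\{0,1\}$ and $\varepsilon_i(n)\varepsilon_{i+1}(n)=0$ for all $i$; $s_Z(n)=\sum_{i\ge0}\varepsilon_i(n)$. -}

module Defs where

open import Data.Nat using (ℕ; zero; suc; _+_; _*_)
open import Data.List using (List; []; _∷_)
open import Data.Product using (_×_)
open import Data.Unit using (⊤)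
open import Data.Empty using (⊥)
open import Relation.Binary.PropositionalEquality using (_≡_)

F : ℕ → ℕ
F zero = 0
F (suc zero) = 1
F (suc (suc n)) = F (suc n) + F n

L : ℕ → ℕ
L zero = 2
L (suc zero) = 1
L (suc (suc n)) = L (suc n) + L n

-- A digit string ε = [ε_0, ε_1, ε_2, ...] (finitely many digits; the
-- remaining digits are 0) with ε_i ∈ {0,1}.
Digits : Set
Digits = List ℕ

valueFrom : ℕ → Digits → ℕ
valueFrom i [] = 0
valueFrom i (e ∷ es) = e * F (i + 2) + valueFrom (suc i) es

value : Digits → ℕ
value = valueFrom 0

IsBinary : ℕ → Set
IsBinary zero = ⊤
IsBinary (suc zero) = ⊤
IsBinary (suc (suc _)) = ⊥

AllBinary : Digits → Set
AllBinary [] = ⊤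
AllBinary (e ∷ es) = IsBinary e × AllBinary es

NoAdjacent : Digits → Set
NoAdjacent [] = ⊤
NoAdjacent (e ∷ []) = ⊤
NoAdjacent (e ∷ e' ∷ es) = (e * e' ≡ 0) × NoAdjacent (e' ∷ es)

IsZeckendorf : Digits → ℕ → Set
IsZeckendorf ε n = AllBinary ε × NoAdjacent ε × (value ε ≡ n)

-- Σ_i ε_i  (this is s_Z(n) when ε is the Zeckendorf representation of n)
digitSum : Digits → ℕ
digitSum [] = 0
digitSum (e ∷ es) = e + digitSum es

-- Zeckendorf representations are unique, so it suffices to exhibit one for L_k + L_l.
-- Writing k = l + d, for d ≥ 4 it is the juxtaposition of those of L_l and L_k
-- (L_{n+3} = F_{n+4} + F_{n+2}), with digit sum 4. For d ≤ 3 a fixed digit string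
-- shifted up by l − 5 positions works: both its value and L_k + L_l, as functions of
-- the shift, satisfy the Fibonacci recurrence, so they agree once they agree at
-- l = 5 and l = 6. The digit sums are 2, 2, 3, 2 for d = 0, 1, 2, 3, so the digit
-- sum is odd exactly when d = 2.
module Submission where

open import Defs
open import Data.Nat using (ℕ; zero; suc; _+_; _*_; _∸_; _≤_; _<_; _%_; z≤n; s≤s; _≤′_; ≤′-refl; ≤′-step)
open import Data.Nat.Properties
open import Data.Nat.ListAction using (sum)
open import Data.Nat.ListAction.Properties using (sum-++; sum-↭)
open import Data.Nat.Tactic.RingSolver using (solve-∀)
open import Algebra.Properties.CommutativeSemigroup +-commutativeSemigroup using (interchange)
open import Data.List using (List; []; _∷_; _++_; _∷ʳ_; length; reverse; replicate)
open import Data.List.Properties using (unfold-reverse; reverse-++; reverse-involutive; length-reverse; length-++; length-replicate)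
open import Data.List.Relation.Binary.Permutation.Propositional.Properties using (↭-reverse)
open import Data.Product using (_×_; _,_; proj₁; ∃-syntax)
open import Data.Unit using (tt)
open import Data.Empty using (⊥-elim)
open import Relation.Binary using (tri<; tri≈; tri>)
open import Relation.Binary.PropositionalEquality
open import Function.Bundles using (_⇔_; mk⇔)
import Function.Properties.Equivalence as ⇔

open ≡-Reasoning

F-mono-suc : ∀ n → F n ≤ F (suc n)
F-mono-suc zero = z≤n
F-mono-suc (suc zero) = s≤s z≤n
F-mono-suc (suc (suc n)) = m≤m+n (F (suc (suc n))) (F (suc n))

F-mono : ∀ {m n} → m ≤ n → F m ≤ F n
F-mono m≤n = go (≤⇒≤′ m≤n)
  where
  go : ∀ {m n} → m ≤′ n → F m ≤ F n
  go ≤′-refl = ≤-refl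
  go {n = suc n} (≤′-step m≤′n) = ≤-trans (go m≤′n) (F-mono-suc n)

record FibLike (G : ℕ → ℕ) : Set where
  constructor fibLike
  field recurrence : ∀ n → G (2 + n) ≡ G (1 + n) + G n

open FibLike

fibLike-+ : ∀ {G H} → FibLike G → FibLike H → FibLike (λ n → G n + H n)
fibLike-+ {G} {H} g h = fibLike λ n →
  trans (cong₂ _+_ (recurrence g n) (recurrence h n))
        (interchange (G (1 + n)) (G n) (H (1 + n)) (H n))

fibLike-unique : ∀ {G H} → FibLike G → FibLike H → G 0 ≡ H 0 → G 1 ≡ H 1 →
                 ∀ n → G n ≡ H n
fibLike-unique {G} {H} g h G0≡H0 G1≡H1 n = proj₁ (agree n)
  where
  agree : ∀ n → G n ≡ H n × G (1 + n) ≡ H (1 + n)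
  agree zero = G0≡H0 , G1≡H1
  agree (suc n) with agree n
  ... | Gn≡Hn , G1+n≡H1+n =
    G1+n≡H1+n , trans (recurrence g n) (trans (cong₂ _+_ G1+n≡H1+n Gn≡Hn) (sym (recurrence h n)))

L-fibLike : ∀ c → FibLike (λ n → L (c + n))
L-fibLike c = fibLike shift
  where
  shift : ∀ n → L (c + (2 + n)) ≡ L (c + (1 + n)) + L (c + n)
  shift n rewrite +-suc c (suc n) | +-suc c n = refl

valueFrom-fibLike : ∀ ds → FibLike (λ i → valueFrom i ds)
valueFrom-fibLike [] = fibLike λ _ → refl
valueFrom-fibLike (e ∷ es) = fibLike λ n →
  trans (cong₂ _+_ (*-distribˡ-+ e (F (1 + n + 2)) (F (n + 2)))
                   (recurrence (valueFrom-fibLike es) (suc n)))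
        (interchange (e * F (1 + n + 2)) (e * F (n + 2)) (valueFrom (2 + n) es) (valueFrom (1 + n) es))

valueFrom-++ : ∀ i xs ys → valueFrom i (xs ++ ys) ≡ valueFrom i xs + valueFrom (i + length xs) ys
valueFrom-++ i [] ys = cong (λ j → valueFrom j ys) (sym (+-identityʳ i))
valueFrom-++ i (x ∷ xs) ys = begin
  x * F (i + 2) + valueFrom (suc i) (xs ++ ys)
    ≡⟨ cong (x * F (i + 2) +_) (valueFrom-++ (suc i) xs ys) ⟩
  x * F (i + 2) + (valueFrom (suc i) xs + valueFrom (suc i + length xs) ys)
    ≡⟨ sym (+-assoc (x * F (i + 2)) _ _) ⟩
  valueFrom i (x ∷ xs) + valueFrom (suc i + length xs) ys
    ≡⟨ cong (λ j → valueFrom i (x ∷ xs) + valueFrom j ys) (sym (+-suc i (length xs))) ⟩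
  valueFrom i (x ∷ xs) + valueFrom (i + length (x ∷ xs)) ys ∎

valueFrom-zeros : ∀ n i ds → valueFrom i (replicate n 0 ++ ds) ≡ valueFrom (i + n) ds
valueFrom-zeros zero i ds = cong (λ j → valueFrom j ds) (sym (+-identityʳ i))
valueFrom-zeros (suc n) i ds =
  trans (valueFrom-zeros n (suc i) ds) (cong (λ j → valueFrom j ds) (sym (+-suc i n)))

allBinary-++ : ∀ {xs ys} → AllBinary xs → AllBinary ys → AllBinary (xs ++ ys)
allBinary-++ {[]} _ ys-ok = ys-ok
allBinary-++ {x ∷ xs} (x-ok , xs-ok) ys-ok = x-ok , allBinary-++ xs-ok ys-ok

allBinary-zeros : ∀ n {ds} → AllBinary ds → AllBinary (replicate n 0 ++ ds)
allBinary-zeros zero ds-ok = ds-ok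
allBinary-zeros (suc n) ds-ok = tt , allBinary-zeros n ds-ok

noAdjacent-tail : ∀ x xs → NoAdjacent (x ∷ xs) → NoAdjacent xs
noAdjacent-tail x [] _ = tt
noAdjacent-tail x (y ∷ xs) (_ , xs-ok) = xs-ok

noAdjacent-0∷ : ∀ ds → NoAdjacent ds → NoAdjacent (0 ∷ ds)
noAdjacent-0∷ [] _ = tt
noAdjacent-0∷ (d ∷ ds) ds-ok = refl , ds-ok

noAdjacent-zeros : ∀ n ds → NoAdjacent ds → NoAdjacent (replicate n 0 ++ ds)
noAdjacent-zeros zero ds ds-ok = ds-ok
noAdjacent-zeros (suc n) ds ds-ok = noAdjacent-0∷ _ (noAdjacent-zeros n ds ds-ok)

noAdjacent-++-0∷ : ∀ xs ys → NoAdjacent xs → NoAdjacent (0 ∷ ys) → NoAdjacent (xs ++ 0 ∷ ys)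
noAdjacent-++-0∷ [] ys _ ys-ok = ys-ok
noAdjacent-++-0∷ (x ∷ []) ys _ ys-ok = *-zeroʳ x , ys-ok
noAdjacent-++-0∷ (x ∷ x′ ∷ xs) ys (xx′≡0 , xs-ok) ys-ok =
  xx′≡0 , noAdjacent-++-0∷ (x′ ∷ xs) ys xs-ok ys-ok

noAdjacent-∷ʳ : ∀ xs y z → NoAdjacent (xs ∷ʳ y) → y * z ≡ 0 → NoAdjacent (xs ++ y ∷ z ∷ [])
noAdjacent-∷ʳ [] y z _ yz≡0 = yz≡0 , tt
noAdjacent-∷ʳ (x ∷ []) y z (xy≡0 , _) yz≡0 = xy≡0 , yz≡0 , tt
noAdjacent-∷ʳ (x ∷ x′ ∷ xs) y z (xx′≡0 , xs-ok) yz≡0 =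
  xx′≡0 , noAdjacent-∷ʳ (x′ ∷ xs) y z xs-ok yz≡0

allBinary-reverse : ∀ xs → AllBinary xs → AllBinary (reverse xs)
allBinary-reverse [] _ = tt
allBinary-reverse (x ∷ xs) (x-ok , xs-ok) rewrite unfold-reverse x xs =
  allBinary-++ (allBinary-reverse xs xs-ok) (x-ok , tt)

noAdjacent-reverse : ∀ xs → NoAdjacent xs → NoAdjacent (reverse xs)
noAdjacent-reverse [] _ = tt
noAdjacent-reverse (x ∷ []) _ = tt
noAdjacent-reverse (x ∷ y ∷ xs) (xy≡0 , xs-ok) =
  subst NoAdjacent (sym (reverse-++ (x ∷ y ∷ []) xs))
    (noAdjacent-∷ʳ (reverse xs) y x
      (subst NoAdjacent (unfold-reverse y xs) (noAdjacent-reverse (y ∷ xs) xs-ok))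
      (trans (*-comm y x) xy≡0))

digitSum≡sum : ∀ ds → digitSum ds ≡ sum ds
digitSum≡sum [] = refl
digitSum≡sum (d ∷ ds) = cong (d +_) (digitSum≡sum ds)

digitSum-++ : ∀ xs ys → digitSum (xs ++ ys) ≡ digitSum xs + digitSum ys
digitSum-++ xs ys = begin
  digitSum (xs ++ ys)       ≡⟨ digitSum≡sum (xs ++ ys) ⟩
  sum (xs ++ ys)            ≡⟨ sum-++ xs ys ⟩
  sum xs + sum ys           ≡⟨ sym (cong₂ _+_ (digitSum≡sum xs) (digitSum≡sum ys)) ⟩
  digitSum xs + digitSum ys ∎

digitSum-reverse : ∀ ds → digitSum (reverse ds) ≡ digitSum ds
digitSum-reverse ds = begin
  digitSum (reverse ds) ≡⟨ digitSum≡sum (reverse ds) ⟩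
  sum (reverse ds)      ≡⟨ sum-↭ (↭-reverse ds) ⟩
  sum ds                ≡⟨ sym (digitSum≡sum ds) ⟩
  digitSum ds           ∎

digitSum-zeros : ∀ n ds → digitSum (replicate n 0 ++ ds) ≡ digitSum ds
digitSum-zeros zero ds = refl
digitSum-zeros (suc n) ds = digitSum-zeros n ds

valueʳ : Digits → ℕ
valueʳ [] = 0
valueʳ (e ∷ es) = e * F (2 + length es) + valueʳ es

value-reverse : ∀ es → value (reverse es) ≡ valueʳ es
value-reverse [] = refl
value-reverse (e ∷ es) = begin
  value (reverse (e ∷ es))
    ≡⟨ cong value (unfold-reverse e es) ⟩
  value (reverse es ∷ʳ e)
    ≡⟨ valueFrom-++ 0 (reverse es) (e ∷ []) ⟩
  value (reverse es) + (e * F (length (reverse es) + 2) + 0)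
    ≡⟨ cong₂ (λ v n → v + (e * F n + 0)) (value-reverse es)
             (trans (cong (_+ 2) (length-reverse es)) (+-comm (length es) 2)) ⟩
  valueʳ es + (e * F (2 + length es) + 0)
    ≡⟨ trans (+-comm (valueʳ es) _) (cong (_+ valueʳ es) (+-identityʳ _)) ⟩
  valueʳ (e ∷ es) ∎

valueʳ-reverse : ∀ es → valueʳ (reverse es) ≡ value es
valueʳ-reverse es = trans (sym (value-reverse (reverse es))) (cong value (reverse-involutive es))

valueʳ<F : ∀ es → AllBinary es → NoAdjacent es → valueʳ es < F (2 + length es)
valueʳ<F [] _ _ = s≤s z≤n
valueʳ<F (zero ∷ es) (_ , es-b) es-a =
  ≤-trans (valueʳ<F es es-b (noAdjacent-tail 0 es es-a)) (F-mono-suc (2 + length es))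
valueʳ<F (1 ∷ []) _ _ = s≤s (s≤s z≤n)
valueʳ<F (1 ∷ 0 ∷ es) (_ , _ , es-b) (_ , es-a) rewrite +-identityʳ (F (3 + length es)) =
  +-monoʳ-< (F (3 + length es)) (valueʳ<F es es-b (noAdjacent-tail 0 es es-a))
valueʳ<F (1 ∷ 1 ∷ es) _ (() , _)
valueʳ<F (1 ∷ suc (suc _) ∷ es) (_ , () , _) _
valueʳ<F (suc (suc _) ∷ es) (() , _) _

F≤valueʳ : ∀ es → F (2 + length es) ≤ valueʳ (1 ∷ es)
F≤valueʳ es rewrite +-identityʳ (F (2 + length es)) = m≤m+n _ _

-- The leading digits must agree: a string starting with 1 is worth at least
-- F (2 + length), which exceeds every admissible string of smaller length.
valueʳ-digitSum-unique : ∀ r s → AllBinary r → NoAdjacent r → AllBinary s → NoAdjacent s →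
                         valueʳ r ≡ valueʳ s → digitSum r ≡ digitSum s
valueʳ-digitSum-unique [] [] _ _ _ _ _ = refl
valueʳ-digitSum-unique (zero ∷ r) s (_ , r-b) r-a s-b s-a eq =
  valueʳ-digitSum-unique r s r-b (noAdjacent-tail 0 r r-a) s-b s-a eq
valueʳ-digitSum-unique r (zero ∷ s) r-b r-a (_ , s-b) s-a eq =
  valueʳ-digitSum-unique r s r-b r-a s-b (noAdjacent-tail 0 s s-a) eq
valueʳ-digitSum-unique (suc (suc _) ∷ r) s (() , _) _ _ _ _
valueʳ-digitSum-unique r (suc (suc _) ∷ s) _ _ (() , _) _ _
valueʳ-digitSum-unique [] (1 ∷ s) _ _ _ _ eq =
  ⊥-elim (<⇒≢ (≤-trans (F-mono {n = 2 + length s} (s≤s (s≤s z≤n))) (F≤valueʳ s)) eq)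
valueʳ-digitSum-unique (1 ∷ r) [] _ _ _ _ eq =
  ⊥-elim (<⇒≢ (≤-trans (F-mono {n = 2 + length r} (s≤s (s≤s z≤n))) (F≤valueʳ r)) (sym eq))
valueʳ-digitSum-unique (1 ∷ r) (1 ∷ s) (_ , r-b) r-a (_ , s-b) s-a eq
  with <-cmp (length r) (length s)
... | tri< r<s _ _ = ⊥-elim (<⇒≢ (<-≤-trans (valueʳ<F (1 ∷ r) (tt , r-b) r-a)
                        (≤-trans (F-mono {n = 2 + length s} (s≤s (s≤s r<s))) (F≤valueʳ s))) eq)
... | tri> _ _ s<r = ⊥-elim (<⇒≢ (<-≤-trans (valueʳ<F (1 ∷ s) (tt , s-b) s-a)
                        (≤-trans (F-mono {n = 2 + length r} (s≤s (s≤s s<r))) (F≤valueʳ r))) (sym eq))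
... | tri≈ _ r≡s _ =
  cong suc (valueʳ-digitSum-unique r s r-b (noAdjacent-tail 1 r r-a) s-b (noAdjacent-tail 1 s s-a)
    (+-cancelˡ-≡ (F (2 + length r) + 0) _ _
      (trans eq (cong (λ n → F (2 + n) + 0 + valueʳ s) (sym r≡s)))))

zeckendorf-digitSum-unique : ∀ {ε δ n} → IsZeckendorf ε n → IsZeckendorf δ n →
                             digitSum ε ≡ digitSum δ
zeckendorf-digitSum-unique {ε} {δ} (ε-b , ε-a , ε≡n) (δ-b , δ-a , δ≡n) = begin
  digitSum ε           ≡⟨ sym (digitSum-reverse ε) ⟩
  digitSum (reverse ε) ≡⟨ valueʳ-digitSum-unique (reverse ε) (reverse δ)
                            (allBinary-reverse ε ε-b) (noAdjacent-reverse ε ε-a)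
                            (allBinary-reverse δ δ-b) (noAdjacent-reverse δ δ-a) valueʳ-eq ⟩
  digitSum (reverse δ) ≡⟨ digitSum-reverse δ ⟩
  digitSum δ           ∎
  where
  valueʳ-eq : valueʳ (reverse ε) ≡ valueʳ (reverse δ)
  valueʳ-eq = trans (valueʳ-reverse ε) (trans ε≡n (trans (sym δ≡n) (sym (valueʳ-reverse δ))))

zeckendorf-zeros : ∀ {ds} → AllBinary ds → NoAdjacent ds →
                   ∀ n → IsZeckendorf (replicate n 0 ++ ds) (valueFrom n ds)
zeckendorf-zeros {ds} ds-b ds-a n =
  allBinary-zeros n ds-b , noAdjacent-zeros n ds ds-a , valueFrom-zeros n 0 ds

fibLike-zeckendorf : ∀ ds {G} → AllBinary ds → NoAdjacent ds → FibLike G →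
                     valueFrom 0 ds ≡ G 0 → valueFrom 1 ds ≡ G 1 →
                     ∀ n → ∃[ δ ] (IsZeckendorf δ (G n) × digitSum δ ≡ digitSum ds)
fibLike-zeckendorf ds ds-b ds-a g ds≡G0 ds≡G1 n =
  replicate n 0 ++ ds ,
  subst (IsZeckendorf _) (fibLike-unique (valueFrom-fibLike ds) g ds≡G0 ds≡G1 n)
        (zeckendorf-zeros ds-b ds-a n) ,
  digitSum-zeros n ds

lucasDigits : ℕ → Digits
lucasDigits n = replicate n 0 ++ 1 ∷ 0 ∷ 1 ∷ []

valueFrom-lucasDigits : ∀ n i → valueFrom i (lucasDigits n) ≡ L (3 + (i + n))
valueFrom-lucasDigits n i =
  trans (valueFrom-zeros n i _)
        (fibLike-unique (valueFrom-fibLike (1 ∷ 0 ∷ 1 ∷ [])) (L-fibLike 3) refl refl (i + n))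

length-lucasDigits : ∀ n → length (lucasDigits n) ≡ n + 3
length-lucasDigits n = trans (length-++ (replicate n 0)) (cong (_+ 3) (length-replicate n))

lucasDigits-++-zeckendorf : ∀ a g →
  IsZeckendorf (lucasDigits a ++ lucasDigits (suc g)) (L (4 + g + (3 + a)) + L (3 + a))
lucasDigits-++-zeckendorf a g =
  allBinary-++ (allBinary-zeros a _) (allBinary-zeros (suc g) _) ,
  noAdjacent-++-0∷ (lucasDigits a) (lucasDigits g)
    (noAdjacent-zeros a _ (refl , refl , tt)) (noAdjacent-zeros (suc g) _ (refl , refl , tt)) ,
  value-eq
  where
  index-eq : ∀ x y → 3 + (x + 3 + suc y) ≡ 4 + y + (3 + x)
  index-eq = solve-∀

  value-eq : value (lucasDigits a ++ lucasDigits (suc g)) ≡ L (4 + g + (3 + a)) + L (3 + a)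
  value-eq = begin
    value (lucasDigits a ++ lucasDigits (suc g))
      ≡⟨ valueFrom-++ 0 (lucasDigits a) (lucasDigits (suc g)) ⟩
    value (lucasDigits a) + valueFrom (length (lucasDigits a)) (lucasDigits (suc g))
      ≡⟨ cong₂ _+_ (valueFrom-lucasDigits a 0)
                   (cong (λ i → valueFrom i (lucasDigits (suc g))) (length-lucasDigits a)) ⟩
    L (3 + a) + valueFrom (a + 3) (lucasDigits (suc g))
      ≡⟨ cong (L (3 + a) +_) (valueFrom-lucasDigits (suc g) (a + 3)) ⟩
    L (3 + a) + L (3 + (a + 3 + suc g))
      ≡⟨ +-comm (L (3 + a)) _ ⟩
    L (3 + (a + 3 + suc g)) + L (3 + a)
      ≡⟨ cong (λ k → L k + L (3 + a)) (index-eq a g) ⟩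
    L (4 + g + (3 + a)) + L (3 + a) ∎

-- s_Z (L (d + l) + L l) for l ≥ 5
sZ-L+L : ℕ → ℕ
sZ-L+L 0 = 2
sZ-L+L 1 = 2
sZ-L+L 2 = 3
sZ-L+L 3 = 2
sZ-L+L (suc (suc (suc (suc _)))) = 4

L+L-zeckendorf : ∀ d {l} → 5 ≤ l → ∃[ δ ] (IsZeckendorf δ (L (d + l) + L l) × digitSum δ ≡ sZ-L+L d)
L+L-zeckendorf 0 (s≤s (s≤s (s≤s (s≤s (s≤s (z≤n {m})))))) =
  fibLike-zeckendorf (1 ∷ 0 ∷ 0 ∷ 0 ∷ 0 ∷ 0 ∷ 1 ∷ []) _
    (refl , refl , refl , refl , refl , refl , tt) (fibLike-+ (L-fibLike 5) (L-fibLike 5)) refl refl m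
L+L-zeckendorf 1 (s≤s (s≤s (s≤s (s≤s (s≤s (z≤n {m})))))) =
  fibLike-zeckendorf (0 ∷ 0 ∷ 0 ∷ 0 ∷ 1 ∷ 0 ∷ 1 ∷ []) _
    (refl , refl , refl , refl , refl , refl , tt) (fibLike-+ (L-fibLike 6) (L-fibLike 5)) refl refl m
L+L-zeckendorf 2 (s≤s (s≤s (s≤s (s≤s (s≤s (z≤n {m})))))) =
  fibLike-zeckendorf (1 ∷ 0 ∷ 0 ∷ 1 ∷ 0 ∷ 0 ∷ 0 ∷ 1 ∷ []) _
    (refl , refl , refl , refl , refl , refl , refl , tt) (fibLike-+ (L-fibLike 7) (L-fibLike 5)) refl refl m
L+L-zeckendorf 3 (s≤s (s≤s (s≤s (s≤s (s≤s (z≤n {m})))))) =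
  fibLike-zeckendorf (0 ∷ 0 ∷ 1 ∷ 0 ∷ 0 ∷ 0 ∷ 0 ∷ 0 ∷ 1 ∷ []) _
    (refl , refl , refl , refl , refl , refl , refl , refl , tt) (fibLike-+ (L-fibLike 8) (L-fibLike 5)) refl refl m
L+L-zeckendorf (suc (suc (suc (suc e)))) (s≤s (s≤s (s≤s (s≤s (s≤s (z≤n {m})))))) =
  lucasDigits (2 + m) ++ lucasDigits (suc e) ,
  lucasDigits-++-zeckendorf (2 + m) e ,
  trans (digitSum-++ (lucasDigits (2 + m)) _) (cong₂ _+_ (digitSum-zeros (2 + m) _) (digitSum-zeros (suc e) _))

sZ-L+L-odd⇔ : ∀ d → (sZ-L+L d % 2 ≡ 1) ⇔ (d ≡ 2)
sZ-L+L-odd⇔ 0 = mk⇔ (λ ()) (λ ())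
sZ-L+L-odd⇔ 1 = mk⇔ (λ ()) (λ ())
sZ-L+L-odd⇔ 2 = mk⇔ (λ _ → refl) (λ _ → refl)
sZ-L+L-odd⇔ 3 = mk⇔ (λ ()) (λ ())
sZ-L+L-odd⇔ (suc (suc (suc (suc _)))) = mk⇔ (λ ()) (λ ())

m∸n≡d⇔m≡n+d : ∀ {m n d} → n ≤ m → (m ∸ n ≡ d) ⇔ (m ≡ n + d)
m∸n≡d⇔m≡n+d {n = n} {d} n≤m =
  mk⇔ (λ m∸n≡d → trans (sym (m+[n∸m]≡n n≤m)) (cong (n +_) m∸n≡d))
      (λ m≡n+d → trans (cong (_∸ n) m≡n+d) (m+n∸m≡n n d))

lemma2p12 : (k l : ℕ) → 5 ≤ l → l ≤ k →
            (ε : Digits) → IsZeckendorf ε (L k + L l) →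
            ((digitSum ε % 2 ≡ 1) ⇔ (k ≡ l + 2))
lemma2p12 k l 5≤l l≤k ε ε-zeck with L+L-zeckendorf (k ∸ l) 5≤l
... | δ , δ-zeck , δ-sum =
  subst (λ s → (s % 2 ≡ 1) ⇔ (k ≡ l + 2)) (sym digitSum-ε)
    (⇔.trans (sZ-L+L-odd⇔ (k ∸ l)) (m∸n≡d⇔m≡n+d l≤k))
  where
  digitSum-ε : digitSum ε ≡ sZ-L+L (k ∸ l)
  digitSum-ε = trans (zeckendorf-digitSum-unique ε-zeck
                       (subst (λ k → IsZeckendorf δ (L k + L l)) (m∸n+n≡m l≤k) δ-zeck))
                     δ-sum
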